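{- Let $\mathbb{F}$ be a field, let $m\ge n+1\ge 2$, let $s,r\ge1$ with $s\le m-1$, and let $f:\mathbb{F}^n\to\mathbb{F}^m$ be a polynomial mapping. Assume that for some $d\ge 1$ we have $\dim A^d_{hom}(f)\ge l_{hom}(s,r,m,d)+1$. Then $f$ is $(s,r)$-weakly elusive.
   Context: $Pol^d_{hom}(\mathbb{F}^m)$ is the space of homogeneous polynomials of degree $d$ in $m$ variables over $\mathbb{F}$, and $Pol^r_{hom}(\mathbb{F}^s,\mathbb{F}^m)$ the space of homogeneous polynomial mappings $\mathbb{F}^s\to\mathbb{F}^m$ of degree $r$ (all components homogeneous of degree $r$). For $\Gamma\in Pol^r_{hom}(\mathbb{F}^s,\mathbb{F}^m)$, $\Gamma^*$ denotes pullback, $\Gamma^*(g)(y)=g(\Gamma(y))$. Define $l_{hom}(s,r,m,d):=\max\{\dim \Gamma^*(Pol^d_{hom}(\mathbb{F}^m)) : \Gamma\in Pol^r_{hom}(\mathbb{F}^s,\mathbb{F}^m)\}$. Let $I^d_{hom}(f(\mathbb{F}^n))$ be the space of homogeneous polynomials of degree $d$ on $\mathbb{F}^m$ vanishing on $f(\mathbb{F}^n)$, and $A^d_{hom}(f):=Pol^d_{hom}(\mathbb{F}^m)/I^d_{hom}(f(\mathbb{F}^n))$. A polynomial mapping $f:\mathbb{F}^n\to\mathbb{F}^m$ is $(s,r)$-weakly elusive if $f(\mathbb{F}^n)$ is not contained in $\Gamma(\mathbb{F}^s)$ for any $\Gamma\in Pol^r_{hom}(\mathbb{F}^s,\mathbb{F}^m)$.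 -}

module Defs where

open import Level using (Level; _⊔_) renaming (suc to lsuc)
open import Algebra.Bundles using (CommutativeRing)
open import Data.Nat as ℕ using (ℕ; zero; suc)
open import Data.Fin using (Fin; zero; suc)
open import Data.Vec as V using (Vec; []; _∷_; lookup; zipWith)
open import Data.Vec.Properties using (≡-dec)
open import Data.List as L using (List)
open import Data.Product using (_×_; _,_; ∃; Σ)
open import Relation.Nullary using (¬_; yes; no)
open import Relation.Binary.PropositionalEquality using (_≡_)

record Field (c ℓ : Level) : Set (lsuc (c ⊔ ℓ)) where
  field
    commutativeRing : CommutativeRing c ℓ
  open CommutativeRing commutativeRing public
  field
    0≉1 : ¬ (0# ≈ 1#)
    inverse : ∀ x → ¬ (x ≈ 0#) → ∃ λ y → (x * y) ≈ 1#

module FieldDefs {c ℓ} (F : Field c ℓ) where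
  open Field F hiding (zero)

  C : Set c
  C = Carrier

  -- Two polynomials are equal iff all
  -- their coefficients (collected over equal exponents) agree.
  Term : ℕ → Set c
  Term n = C × Vec ℕ n

  Poly : ℕ → Set c
  Poly n = List (Term n)

  coeff : ∀ {n} → Poly n → Vec ℕ n → C
  coeff L.[]             e = 0#
  coeff ((a , e′) L.∷ p) e with ≡-dec ℕ._≟_ e e′
  ... | yes _ = a + coeff p e
  ... | no  _ = coeff p e

  IsZeroPoly : ∀ {n} → Poly n → Set ℓ
  IsZeroPoly p = ∀ e → coeff p e ≈ 0#

  IsHom : ∀ {n} → ℕ → Poly n → Set ℓ
  IsHom d p = ∀ e → ¬ (V.sum e ≡ d) → coeff p e ≈ 0#

  PolyMap : ℕ → ℕ → Set c
  PolyMap s m = Vec (Poly s) m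

  IsHomMap : ∀ {s m} → ℕ → PolyMap s m → Set ℓ
  IsHomMap r Γ = ∀ i → IsHom r (lookup Γ i)

  powC : C → ℕ → C
  powC x zero    = 1#
  powC x (suc k) = x * powC x k

  evalMon : ∀ {n} → Vec ℕ n → Vec C n → C
  evalMon e x = V.foldr _ _*_ 1# (zipWith powC x e)

  eval : ∀ {n} → Poly n → Vec C n → C
  eval L.[]             x = 0#
  eval ((a , e) L.∷ p) x = a * evalMon e x + eval p x

  evalMap : ∀ {s m} → PolyMap s m → Vec C s → Vec C m
  evalMap Γ y = V.map (λ P → eval P y) Γ

  scale : ∀ {n} → C → Poly n → Poly n
  scale a = L.map (λ { (b , e) → (a * b , e) })

  one : ∀ {n} → Poly n
  one {n} = (1# , V.replicate n 0) L.∷ L.[]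

  mul : ∀ {n} → Poly n → Poly n → Poly n
  mul p q = L.concatMap (λ { (a , e) → L.map (λ { (b , e′) → (a * b , zipWith ℕ._+_ e e′) }) q }) p

  pow : ∀ {n} → Poly n → ℕ → Poly n
  pow p zero    = one
  pow p (suc k) = mul p (pow p k)

  monSubst : ∀ {s m} → Vec ℕ m → PolyMap s m → Poly s
  monSubst []      []      = one
  monSubst (k ∷ e) (P ∷ Γ) = mul (pow P k) (monSubst e Γ)

  pullback : ∀ {s m} → PolyMap s m → Poly m → Poly s
  pullback Γ g = L.concatMap (λ { (a , e) → scale a (monSubst e Γ) }) g

  linComb : ∀ {n} (k : ℕ) → (Fin k → C) → (Fin k → Poly n) → Poly n
  linComb zero    a g = L.[]
  linComb (suc k) a g = scale (a zero) (g zero) L.++ linComb k (λ i → a (suc i)) (λ i → g (suc i))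

  -- dim Γ^*(Pol^d_hom(F^m)) ≥ k : there are g_1..g_k ∈ Pol^d_hom(F^m)
  -- whose pullbacks are linearly independent
  PullbackDimAtLeast : ∀ {s m} → PolyMap s m → ℕ → ℕ → Set (c ⊔ ℓ)
  PullbackDimAtLeast {s} {m} Γ d k =
    Σ (Fin k → Poly m) λ g → (∀ i → IsHom d (g i)) ×
      (∀ (a : Fin k → C) → IsZeroPoly (linComb k a (λ i → pullback Γ (g i))) → ∀ i → a i ≈ 0#)

  -- l_hom(s,r,m,d) = l : l is the maximum of dim Γ^*(Pol^d_hom(F^m))
  -- over homogeneous Γ : F^s → F^m of degree r
  IsLhom : ℕ → ℕ → ℕ → ℕ → ℕ → Set (c ⊔ ℓ)
  IsLhom s r m d l =
    (∃ λ (Γ : PolyMap s m) → IsHomMap r Γ × PullbackDimAtLeast Γ d l) ×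
    (∀ (Γ : PolyMap s m) → IsHomMap r Γ → ¬ PullbackDimAtLeast Γ d (suc l))

  VanishesOnImage : ∀ {n m} → PolyMap n m → Poly m → Set (c ⊔ ℓ)
  VanishesOnImage f g = ∀ x → eval g (evalMap f x) ≈ 0#

  -- dim A^d_hom(f) = dim Pol^d_hom(F^m) / I^d_hom(f(F^n)) ≥ k : there are
  -- g_1..g_k ∈ Pol^d_hom(F^m) linearly independent modulo I^d_hom(f(F^n))
  ADimAtLeast : ∀ {n m} → PolyMap n m → ℕ → ℕ → Set (c ⊔ ℓ)
  ADimAtLeast {n} {m} f d k =
    Σ (Fin k → Poly m) λ g → (∀ i → IsHom d (g i)) ×
      (∀ (a : Fin k → C) → VanishesOnImage f (linComb k a g) → ∀ i → a i ≈ 0#)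

  ImageContained : ∀ {n s m} → PolyMap n m → PolyMap s m → Set (c ⊔ ℓ)
  ImageContained f Γ = ∀ x → ∃ λ y → ∀ i → lookup (evalMap f x) i ≈ lookup (evalMap Γ y) i

  WeaklyElusive : ∀ {n m} → ℕ → ℕ → PolyMap n m → Set (c ⊔ ℓ)
  WeaklyElusive {n} {m} s r f = ∀ (Γ : PolyMap s m) → IsHomMap r Γ → ¬ ImageContained f Γ

-- If f(F^n) ⊆ Γ(F^s), a polynomial g vanishes on f(F^n) as soon as Γ^*(g) = 0, so
-- forms independent modulo I^d_hom(f(F^n)) have independent pullbacks under Γ:
-- dim A^d_hom(f) ≤ dim Γ^*(Pol^d_hom(F^m)) ≤ l_hom(s,r,m,d). Constructively the only extra work is to show that
-- l_hom exists at all (¬¬ suffices, the goal being a negation): pullback dimensions are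
-- bounded, since more than (d+1)^m degree-d forms in m variables are linearly dependent.
module Submission where

open import Defs
open import Level using (_⊔_)
open import Data.Nat as ℕ using (ℕ; zero; suc; _≤_; _<_; _∸_; _^_; z≤n; s≤s)
open import Data.Nat.Properties using (≤-refl; ≤-reflexive; ≤-trans; m≤m+n; m≤n+m; m≤n⇒m≤1+n; 1+n≰n)
open import Data.Fin using (Fin; zero; suc; punchIn; toℕ; fromℕ<; funToFin; finToFun)
open import Data.Fin.Properties using (toℕ-fromℕ<; finToFun-funToFin)
open import Data.Vec as V using (Vec; []; _∷_; lookup; zipWith; tabulate)
open import Data.Vec.Properties using (≡-dec; tabulate-cong; tabulate∘lookup)
open import Data.Vec.Functional using (insertAt)
open import Data.Vec.Functional.Properties using (insertAt-lookup; insertAt-punchIn)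
open import Data.List as L using ([]; _∷_)
open import Data.Product using (∃; _×_; _,_; proj₁; proj₂)
open import Data.Sum using (_⊎_; inj₁; inj₂)
open import Data.Empty using (⊥-elim)
open import Function using (_∘_)
open import Relation.Nullary using (¬_; yes; no)
open import Relation.Nullary.Decidable using (decidable-stable; ¬¬-excluded-middle)
open import Relation.Binary.PropositionalEquality as ≡ using (_≡_)

¬¬-∃¬⊎∀ : ∀ {p} {k} (P : Fin k → Set p) → ¬ ¬ ((∃ λ i → ¬ P i) ⊎ (∀ i → P i))
¬¬-∃¬⊎∀ {k = zero}  P give = give (inj₂ λ ())
¬¬-∃¬⊎∀ {k = suc k} P give = ¬¬-excluded-middle λ
  { (no ¬P₀) → give (inj₁ (zero , ¬P₀))
  ; (yes P₀) → ¬¬-∃¬⊎∀ (P ∘ suc) λ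
      { (inj₁ (i , ¬Pᵢ)) → give (inj₁ (suc i , ¬Pᵢ))
      ; (inj₂ Pₛ)        → give (inj₂ λ { zero → P₀ ; (suc i) → Pₛ i }) } }

¬¬-∃-maximal : ∀ {p} (P : ℕ → Set p) (B : ℕ) → P 0 → ¬ P (suc B) →
               ¬ ¬ (∃ λ l → P l × ¬ P (suc l))
¬¬-∃-maximal P B P₀ ¬P[1+B] noMaximal = ¬¬P (suc B) ¬P[1+B]
  where
  ¬¬P : ∀ k → ¬ ¬ P k
  ¬¬P zero    ¬P₀ = ¬P₀ P₀
  ¬¬P (suc k) ¬P[1+k] = ¬¬P k λ Pₖ → noMaximal (k , Pₖ , ¬P[1+k])

lookup≤sum : ∀ {m} (e : Vec ℕ m) i → lookup e i ≤ V.sum e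
lookup≤sum (x ∷ e) zero    = m≤m+n x (V.sum e)
lookup≤sum (x ∷ e) (suc i) = ≤-trans (lookup≤sum e i) (m≤n+m (V.sum e) x)

-- Exponent vectors with entries ≤ d, indexed by the digits of j in base d + 1.
exponent : ∀ {m} d → Fin (suc d ^ m) → Vec ℕ m
exponent d j = tabulate (toℕ ∘ finToFun j)

exponent-surjective : ∀ {m} d (e : Vec ℕ m) → V.sum e ≤ d → ∃ λ j → exponent d j ≡ e
exponent-surjective d e sum≤d = funToFin digit , (begin
  tabulate (toℕ ∘ finToFun (funToFin digit)) ≡⟨ tabulate-cong (≡.cong toℕ ∘ finToFun-funToFin digit) ⟩
  tabulate (toℕ ∘ digit)                     ≡⟨ tabulate-cong (λ i → toℕ-fromℕ< (digit< i)) ⟩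
  tabulate (lookup e)                        ≡⟨ tabulate∘lookup e ⟩
  e                                          ∎)
  where
  open ≡.≡-Reasoning
  digit< : ∀ i → lookup e i < suc d
  digit< i = s≤s (≤-trans (lookup≤sum e i) sum≤d)
  digit : Fin _ → Fin (suc d)
  digit i = fromℕ< (digit< i)

module _ {c ℓ} (F : Field c ℓ) where
  open Field F hiding (zero)
  open FieldDefs F
  open import Relation.Binary.Reasoning.Setoid setoid
  open import Algebra.Properties.Semiring.Sum semiring
    using (sum-syntax; sum-cong-≋; sum-replicate-zero; sum-remove; ∑-distrib-+; *-distribʳ-sum)
  open import Algebra.Properties.CommutativeSemigroup +-commutativeSemigroup
    using (x∙yz≈y∙xz)
  open import Algebra.Properties.CommutativeSemigroup *-commutativeSemigroup
    using () renaming (interchange to *-interchange)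
  open import Algebra.Properties.Ring ring using (x[y-z]≈xy-xz; -‿distribˡ-*)
  open import Algebra.Properties.Group +-group using (//-rightDividesˡ; \\-leftDividesʳ)

  ∑-zero : ∀ {k} {t : Fin k → C} → (∀ i → t i ≈ 0#) → ∑[ i < k ] t i ≈ 0#
  ∑-zero {k} t≈0 = trans (sum-cong-≋ t≈0) (sum-replicate-zero k)

  LinearlyIndependent : ∀ {k N} → (Fin k → Fin N → C) → Set (c ⊔ ℓ)
  LinearlyIndependent {k} {N} v =
    ∀ (a : Fin k → C) → (∀ j → ∑[ i < k ] (a i * v i j) ≈ 0#) → ∀ i → a i ≈ 0#

  independent-dropZeroColumn : ∀ {k N} (v : Fin k → Fin (suc N) → C) → (∀ i → v i zero ≈ 0#) →
                               LinearlyIndependent v → LinearlyIndependent (λ i j → v i (suc j))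
  independent-dropZeroColumn v v₀≈0 independent a combination = independent a λ
    { zero    → ∑-zero (λ i → trans (*-congˡ (v₀≈0 i)) (zeroʳ (a i)))
    ; (suc j) → combination j }

  independent-eliminate : ∀ {k N} (v : Fin (suc k) → Fin N → C) (p : Fin (suc k)) (c : Fin k → C) →
                          LinearlyIndependent v →
                          LinearlyIndependent (λ i j → v (punchIn p i) j - c i * v p j)
  independent-eliminate {k} v p c independent b combination i =
    trans (sym (reflexive (insertAt-punchIn b p (- T) i))) (independent a lifted (punchIn p i))
    where
    T = ∑[ i < k ] (b i * c i)
    a = insertAt b p (- T)
    splitTerm : ∀ b v c x → b * v ≈ (b * c) * x + b * (v - c * x)
    splitTerm b v c x = sym (begin
      (b * c) * x + b * (v - c * x)        ≈⟨ +-cong (*-assoc b c x) (x[y-z]≈xy-xz b v (c * x)) ⟩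
      b * (c * x) + (b * v - b * (c * x))  ≈⟨ +-comm _ _ ⟩
      (b * v - b * (c * x)) + b * (c * x)  ≈⟨ //-rightDividesˡ (b * (c * x)) (b * v) ⟩
      b * v                                ∎)
    lifted : ∀ j → ∑[ i < suc k ] (a i * v i j) ≈ 0#
    lifted j = begin
      ∑[ i < suc k ] (a i * v i j)
        ≈⟨ sum-remove {i = p} (λ i → a i * v i j) ⟩
      a p * x + ∑[ i < k ] (a (punchIn p i) * v (punchIn p i) j)
        ≈⟨ +-cong (*-congʳ (reflexive (insertAt-lookup b p (- T))))
                  (sum-cong-≋ λ i → *-congʳ (reflexive (insertAt-punchIn b p (- T) i))) ⟩
      - T * x + ∑[ i < k ] (b i * v (punchIn p i) j)
        ≈⟨ +-congˡ (sum-cong-≋ λ i → splitTerm (b i) (v (punchIn p i) j) (c i) x) ⟩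
      - T * x + ∑[ i < k ] ((b i * c i) * x + b i * w i)
        ≈⟨ +-congˡ (∑-distrib-+ (λ i → (b i * c i) * x) (λ i → b i * w i)) ⟩
      - T * x + (∑[ i < k ] ((b i * c i) * x) + ∑[ i < k ] (b i * w i))
        ≈⟨ +-cong (sym (-‿distribˡ-* T x)) (+-congʳ (sym (*-distribʳ-sum x (λ i → b i * c i)))) ⟩
      - (T * x) + (T * x + ∑[ i < k ] (b i * w i))
        ≈⟨ \\-leftDividesʳ (T * x) _ ⟩
      ∑[ i < k ] (b i * w i)
        ≈⟨ combination j ⟩
      0# ∎
      where
      x = v p j
      w = λ i → v (punchIn p i) j - c i * v p j

  x-xπy≈0 : ∀ x y π → y * π ≈ 1# → x - (x * π) * y ≈ 0#
  x-xπy≈0 x y π yπ≈1 = begin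
    x - (x * π) * y  ≈⟨ +-congˡ (-‿cong (trans (*-assoc x π y) (*-congˡ (trans (*-comm π y) yπ≈1)))) ⟩
    x - x * 1#       ≈⟨ +-congˡ (-‿cong (*-identityʳ x)) ⟩
    x - x            ≈⟨ -‿inverseʳ x ⟩
    0#               ∎

  independent⇒≤ : ∀ {k} N (v : Fin k → Fin N → C) → LinearlyIndependent v → k ≤ N
  independent⇒≤ {zero}  N       v independent = z≤n
  independent⇒≤ {suc k} zero    v independent = ⊥-elim (0≉1 (sym (independent (λ _ → 1#) (λ ()) zero)))
  independent⇒≤ {suc k} (suc N) v independent = decidable-stable (suc k ℕ.≤? suc N) λ k≰N →
    ¬¬-∃¬⊎∀ (λ i → v i zero ≈ 0#) λ
    { (inj₂ v₀≈0) → k≰N (m≤n⇒m≤1+n (independent⇒≤ N (λ i j → v i (suc j))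
        (independent-dropZeroColumn v v₀≈0 independent)))
    ; (inj₁ (p , vₚ₀≉0)) → k≰N (s≤s (afterPivot p vₚ₀≉0)) }
    where
    afterPivot : ∀ p → ¬ v p zero ≈ 0# → k ≤ N
    afterPivot p vₚ₀≉0 = independent⇒≤ N (λ i j → w i (suc j))
      (independent-dropZeroColumn w (λ i → x-xπy≈0 (v (punchIn p i) zero) (v p zero) π vₚ₀π≈1)
        (independent-eliminate v p ratio independent))
      where
      π = proj₁ (inverse (v p zero) vₚ₀≉0)
      vₚ₀π≈1 = proj₂ (inverse (v p zero) vₚ₀≉0)
      ratio = λ i → v (punchIn p i) zero * π
      w = λ i j → v (punchIn p i) j - ratio i * v p j

  extend : ∀ {n} → (Vec ℕ n → C) → Poly n → C
  extend h []             = 0#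
  extend h ((a , e) ∷ p) = a * h e + extend h p

  extend-cong : ∀ {n} {h h′ : Vec ℕ n → C} (p : Poly n) → (∀ e → h e ≈ h′ e) → extend h p ≈ extend h′ p
  extend-cong []             h≈h′ = refl
  extend-cong ((a , e) ∷ p) h≈h′ = +-cong (*-congˡ (h≈h′ e)) (extend-cong p h≈h′)

  extend-++ : ∀ {n} (h : Vec ℕ n → C) (p q : Poly n) → extend h (p L.++ q) ≈ extend h p + extend h q
  extend-++ h []             q = sym (+-identityˡ _)
  extend-++ h ((a , e) ∷ p) q = trans (+-congˡ (extend-++ h p q)) (sym (+-assoc _ _ _))

  extend-scale : ∀ {n} (h : Vec ℕ n → C) a (p : Poly n) → extend h (scale a p) ≈ a * extend h p
  extend-scale h a []             = sym (zeroʳ a)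
  extend-scale h a ((b , e) ∷ p) =
    trans (+-cong (*-assoc a b (h e)) (extend-scale h a p)) (sym (distribˡ a _ _))

  extend-linComb : ∀ {n} (h : Vec ℕ n → C) k (a : Fin k → C) (g : Fin k → Poly n) →
                   extend h (linComb k a g) ≈ ∑[ i < k ] (a i * extend h (g i))
  extend-linComb h zero    a g = refl
  extend-linComb h (suc k) a g = trans (extend-++ h (scale (a zero) (g zero)) _)
    (+-cong (extend-scale h (a zero) (g zero)) (extend-linComb h k (a ∘ suc) (g ∘ suc)))

  Multiplicative : ∀ {n} → (Vec ℕ n → C) → Set ℓ
  Multiplicative h = ∀ e e′ → h (zipWith ℕ._+_ e e′) ≈ h e * h e′

  -- φ stands for the term-shifting lambda inside the definition of mul.
  extend-shift : ∀ {n} {h : Vec ℕ n → C} → Multiplicative h → ∀ a e (φ : Term n → Term n) →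
                 (∀ b e′ → φ (b , e′) ≡ (a * b , zipWith ℕ._+_ e e′)) →
                 ∀ q → extend h (L.map φ q) ≈ (a * h e) * extend h q
  extend-shift mult a e φ φ-shifts []              = sym (zeroʳ _)
  extend-shift {h = h} mult a e φ φ-shifts ((b , e′) ∷ q) rewrite φ-shifts b e′ = begin
    (a * b) * h (zipWith ℕ._+_ e e′) + extend h (L.map φ q)
      ≈⟨ +-cong (*-congˡ (mult e e′)) (extend-shift mult a e φ φ-shifts q) ⟩
    (a * b) * (h e * h e′) + (a * h e) * extend h q
      ≈⟨ +-congʳ (*-interchange a b (h e) (h e′)) ⟩
    (a * h e) * (b * h e′) + (a * h e) * extend h q
      ≈⟨ sym (distribˡ (a * h e) _ _) ⟩
    (a * h e) * (b * h e′ + extend h q) ∎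

  extend-mul : ∀ {n} {h : Vec ℕ n → C} → Multiplicative h →
               ∀ (p q : Poly n) → extend h (mul p q) ≈ extend h p * extend h q
  extend-mul         mult []             q = sym (zeroˡ _)
  extend-mul {h = h} mult ((a , e) ∷ p) q = begin
    extend h (L.map _ q L.++ mul p q)           ≈⟨ extend-++ h (L.map _ q) (mul p q) ⟩
    extend h (L.map _ q) + extend h (mul p q)   ≈⟨ +-cong (extend-shift mult a e _ (λ _ _ → ≡.refl) q)
                                                          (extend-mul mult p q) ⟩
    (a * h e) * extend h q + extend h p * extend h q  ≈⟨ sym (distribʳ _ _ _) ⟩
    (a * h e + extend h p) * extend h q         ∎

  extend-pullback : ∀ {s m} (h : Vec ℕ s → C) (Γ : PolyMap s m) (g : Poly m) →
                    extend h (pullback Γ g) ≈ extend (λ e → extend h (monSubst e Γ)) g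
  extend-pullback h Γ []             = refl
  extend-pullback h Γ ((a , e) ∷ g) = trans (extend-++ h (scale a (monSubst e Γ)) _)
    (+-cong (extend-scale h a (monSubst e Γ)) (extend-pullback h Γ g))

  extend-linComb-pullback : ∀ {s m} (h : Vec ℕ s → C) (Γ : PolyMap s m) k (a : Fin k → C) (g : Fin k → Poly m) →
                            extend h (linComb k a (pullback Γ ∘ g)) ≈
                            extend (λ e → extend h (monSubst e Γ)) (linComb k a g)
  extend-linComb-pullback h Γ k a g = begin
    extend h (linComb k a (pullback Γ ∘ g))   ≈⟨ extend-linComb h k a (pullback Γ ∘ g) ⟩
    ∑[ i < k ] (a i * extend h (pullback Γ (g i)))  ≈⟨ sum-cong-≋ (λ i → *-congˡ (extend-pullback h Γ (g i))) ⟩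
    ∑[ i < k ] (a i * extend hΓ (g i))        ≈⟨ extend-linComb hΓ k a g ⟨
    extend hΓ (linComb k a g)                 ∎
    where hΓ = λ e → extend h (monSubst e Γ)

  δ : ∀ {n} → Vec ℕ n → Vec ℕ n → C
  δ e e′ with ≡-dec ℕ._≟_ e e′
  ... | yes _ = 1#
  ... | no  _ = 0#

  coeff≈extend-δ : ∀ {n} (p : Poly n) e → coeff p e ≈ extend (δ e) p
  coeff≈extend-δ []              e = refl
  coeff≈extend-δ ((a , e′) ∷ p) e with ≡-dec ℕ._≟_ e e′
  ... | yes _ = +-cong (sym (*-identityʳ a)) (coeff≈extend-δ p e)
  ... | no  _ = trans (sym (+-identityˡ _)) (+-cong (sym (zeroʳ a)) (coeff≈extend-δ p e))

  coeff-linComb : ∀ {n} k (a : Fin k → C) (g : Fin k → Poly n) e →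
                  coeff (linComb k a g) e ≈ ∑[ i < k ] (a i * coeff (g i) e)
  coeff-linComb k a g e = trans (coeff≈extend-δ (linComb k a g) e) (trans (extend-linComb (δ e) k a g)
    (sum-cong-≋ λ i → *-congˡ (sym (coeff≈extend-δ (g i) e))))

  coeff-∷-≢ : ∀ {n} a {e′ e} (p : Poly n) → ¬ e ≡ e′ → coeff ((a , e′) ∷ p) e ≈ coeff p e
  coeff-∷-≢ a {e′} {e} p e≢e′ with ≡-dec ℕ._≟_ e e′
  ... | yes e≡e′ = ⊥-elim (e≢e′ e≡e′)
  ... | no  _    = refl

  coeff-∷-cong : ∀ {n} (t : Term n) (p q : Poly n) e → coeff p e ≈ coeff q e → coeff (t ∷ p) e ≈ coeff (t ∷ q) e
  coeff-∷-cong (a , e′) p q e p≈q with ≡-dec ℕ._≟_ e e′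
  ... | yes _ = +-congˡ p≈q
  ... | no  _ = p≈q

  without : ∀ {n} → Vec ℕ n → Poly n → Poly n
  without e []              = []
  without e ((a , e′) ∷ p) with ≡-dec ℕ._≟_ e e′
  ... | yes _ = without e p
  ... | no  _ = (a , e′) ∷ without e p

  extend-without : ∀ {n} (h : Vec ℕ n → C) e (p : Poly n) → extend h p ≈ coeff p e * h e + extend h (without e p)
  extend-without h e [] = sym (trans (+-identityʳ _) (zeroˡ (h e)))
  extend-without h e ((a , e′) ∷ p) with ≡-dec ℕ._≟_ e e′
  ... | yes ≡.refl = begin
    a * h e + extend h p                                   ≈⟨ +-congˡ (extend-without h e p) ⟩
    a * h e + (coeff p e * h e + extend h (without e p))   ≈⟨ sym (+-assoc _ _ _) ⟩
    (a * h e + coeff p e * h e) + extend h (without e p)   ≈⟨ +-congʳ (sym (distribʳ (h e) a _)) ⟩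
    (a + coeff p e) * h e + extend h (without e p)         ∎
  ... | no _ = trans (+-congˡ (extend-without h e p)) (x∙yz≈y∙xz _ _ _)

  coeff-without-self : ∀ {n} e (p : Poly n) → coeff (without e p) e ≈ 0#
  coeff-without-self e []              = refl
  coeff-without-self e ((a , e′) ∷ p) with ≡-dec ℕ._≟_ e e′
  ... | yes _    = coeff-without-self e p
  ... | no e≢e′ = trans (coeff-∷-≢ a (without e p) e≢e′) (coeff-without-self e p)

  coeff-without-other : ∀ {n} e {e′} (p : Poly n) → ¬ e′ ≡ e → coeff (without e p) e′ ≈ coeff p e′
  coeff-without-other e []               e′≢e = refl
  coeff-without-other e {e′} ((a , e″) ∷ p) e′≢e with ≡-dec ℕ._≟_ e e″
  ... | yes ≡.refl = trans (coeff-without-other e p e′≢e) (sym (coeff-∷-≢ a p e′≢e))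
  ... | no  _      = coeff-∷-cong (a , e″) (without e p) p e′ (coeff-without-other e p e′≢e)

  without-isZero : ∀ {n} e (p : Poly n) → IsZeroPoly p → IsZeroPoly (without e p)
  without-isZero e p p≈0 e′ with ≡-dec ℕ._≟_ e′ e
  ... | yes ≡.refl = coeff-without-self e p
  ... | no e′≢e    = trans (coeff-without-other e p e′≢e) (p≈0 e′)

  length-without : ∀ {n} e (p : Poly n) → L.length (without e p) ≤ L.length p
  length-without e []              = z≤n
  length-without e ((a , e′) ∷ p) with ≡-dec ℕ._≟_ e e′
  ... | yes _ = m≤n⇒m≤1+n (length-without e p)
  ... | no  _ = s≤s (length-without e p)

  length-without-head : ∀ {n} a e (p : Poly n) → L.length (without e ((a , e) ∷ p)) ≤ L.length p
  length-without-head a e p with ≡-dec ℕ._≟_ e e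
  ... | yes _   = length-without e p
  ... | no e≢e = ⊥-elim (e≢e ≡.refl)

  -- Removing every term with the head's exponent shortens p and keeps it zero.
  extend-isZero : ∀ {n} (h : Vec ℕ n → C) (p : Poly n) → IsZeroPoly p → extend h p ≈ 0#
  extend-isZero h p = bounded (L.length p) p ≤-refl
    where
    bounded : ∀ b q → L.length q ≤ b → IsZeroPoly q → extend h q ≈ 0#
    bounded _       []              _         _   = refl
    bounded (suc b) q@((a , e) ∷ p) (s≤s |p|≤b) q≈0 = begin
      extend h q                                ≈⟨ extend-without h e q ⟩
      coeff q e * h e + extend h (without e q)  ≈⟨ +-cong (*-congʳ (q≈0 e))
        (bounded b (without e q) (≤-trans (length-without-head a e p) |p|≤b) (without-isZero e q q≈0)) ⟩
      0# * h e + 0#                             ≈⟨ +-identityʳ _ ⟩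
      0# * h e                                  ≈⟨ zeroˡ (h e) ⟩
      0#                                        ∎

  linComb-pullback-isZero : ∀ {s m} (Γ : PolyMap s m) k (a : Fin k → C) (g : Fin k → Poly m) →
                            IsZeroPoly (linComb k a g) → IsZeroPoly (linComb k a (pullback Γ ∘ g))
  linComb-pullback-isZero Γ k a g lc≈0 e′ =
    trans (coeff≈extend-δ (linComb k a (pullback Γ ∘ g)) e′)
      (trans (extend-linComb-pullback (δ e′) Γ k a g) (extend-isZero _ (linComb k a g) lc≈0))

  eval≡extend : ∀ {n} (p : Poly n) x → eval p x ≡ extend (λ e → evalMon e x) p
  eval≡extend []             x = ≡.refl
  eval≡extend ((a , e) ∷ p) x = ≡.cong (a * evalMon e x +_) (eval≡extend p x)

  powC-+ : ∀ x k k′ → powC x (k ℕ.+ k′) ≈ powC x k * powC x k′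
  powC-+ x zero    k′ = sym (*-identityˡ _)
  powC-+ x (suc k) k′ = trans (*-congˡ (powC-+ x k k′)) (sym (*-assoc x _ _))

  powC-cong : ∀ {x x′} k → x ≈ x′ → powC x k ≈ powC x′ k
  powC-cong zero    x≈x′ = refl
  powC-cong (suc k) x≈x′ = *-cong x≈x′ (powC-cong k x≈x′)

  evalMon-multiplicative : ∀ {n} (x : Vec C n) → Multiplicative (λ e → evalMon e x)
  evalMon-multiplicative []      []       []        = sym (*-identityˡ 1#)
  evalMon-multiplicative (y ∷ x) (k ∷ e) (k′ ∷ e′) =
    trans (*-cong (powC-+ y k k′) (evalMon-multiplicative x e e′)) (*-interchange _ _ _ _)

  evalMon-zero : ∀ {n} (x : Vec C n) → evalMon (V.replicate n 0) x ≈ 1#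
  evalMon-zero []      = refl
  evalMon-zero (y ∷ x) = trans (*-identityˡ _) (evalMon-zero x)

  evalMon-cong : ∀ {n} e (x x′ : Vec C n) → (∀ i → lookup x i ≈ lookup x′ i) → evalMon e x ≈ evalMon e x′
  evalMon-cong []      []      []        x≈x′ = refl
  evalMon-cong (k ∷ e) (_ ∷ x) (_ ∷ x′) x≈x′ =
    *-cong (powC-cong k (x≈x′ zero)) (evalMon-cong e x x′ (x≈x′ ∘ suc))

  eval-mul : ∀ {n} (p q : Poly n) x → eval (mul p q) x ≈ eval p x * eval q x
  eval-mul p q x rewrite eval≡extend (mul p q) x | eval≡extend p x | eval≡extend q x =
    extend-mul (evalMon-multiplicative x) p q

  eval-one : ∀ {n} (x : Vec C n) → eval one x ≈ 1#
  eval-one x = trans (+-identityʳ _) (trans (*-identityˡ _) (evalMon-zero x))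

  eval-pow : ∀ {n} (p : Poly n) k x → eval (pow p k) x ≈ powC (eval p x) k
  eval-pow p zero    x = eval-one x
  eval-pow p (suc k) x = trans (eval-mul p (pow p k) x) (*-congˡ (eval-pow p k x))

  eval-monSubst : ∀ {s m} e (Γ : PolyMap s m) y → eval (monSubst e Γ) y ≈ evalMon e (evalMap Γ y)
  eval-monSubst []      []      y = eval-one y
  eval-monSubst (k ∷ e) (P ∷ Γ) y =
    trans (eval-mul (pow P k) (monSubst e Γ) y) (*-cong (eval-pow P k y) (eval-monSubst e Γ y))

  vanishesOnImage : ∀ {n s m} (f : PolyMap n m) (Γ : PolyMap s m) → ImageContained f Γ →
                    ∀ k (a : Fin k → C) (g : Fin k → Poly m) →
                    IsZeroPoly (linComb k a (pullback Γ ∘ g)) → VanishesOnImage f (linComb k a g)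
  vanishesOnImage f Γ f⊆Γ k a g pullback≈0 x = begin
    eval lc (evalMap f x)                          ≡⟨ eval≡extend lc (evalMap f x) ⟩
    extend (at (evalMap f x)) lc                   ≈⟨ extend-cong lc (λ e → evalMon-cong e (evalMap f x) (evalMap Γ y) fx≈Γy) ⟩
    extend (at (evalMap Γ y)) lc                   ≈⟨ extend-cong lc (λ e → sym (eval-monSubst e Γ y)) ⟩
    extend (λ e → eval (monSubst e Γ) y) lc        ≈⟨ extend-cong lc (λ e → reflexive (eval≡extend (monSubst e Γ) y)) ⟩
    extend (λ e → extend (at y) (monSubst e Γ)) lc ≈⟨ extend-linComb-pullback (at y) Γ k a g ⟨
    extend (at y) (linComb k a (pullback Γ ∘ g))   ≈⟨ extend-isZero (at y) (linComb k a (pullback Γ ∘ g)) pullback≈0 ⟩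
    0#                                             ∎
    where
    lc = linComb k a g
    y = proj₁ (f⊆Γ x)
    fx≈Γy = proj₂ (f⊆Γ x)
    at : ∀ {n} → Vec C n → Vec ℕ n → C
    at z e = evalMon e z

  pullbackDimAtLeast-zero : ∀ {s m} (Γ : PolyMap s m) d → PullbackDimAtLeast Γ d 0
  pullbackDimAtLeast-zero Γ d = (λ ()) , (λ ()) , (λ a _ ())

  imageContained⇒pullbackDimAtLeast : ∀ {n s m} (f : PolyMap n m) (Γ : PolyMap s m) → ImageContained f Γ →
                                      ∀ d k → ADimAtLeast f d k → PullbackDimAtLeast Γ d k
  imageContained⇒pullbackDimAtLeast f Γ f⊆Γ d k (g , g-hom , independentModI) =
    g , g-hom , λ a pullback≈0 → independentModI a (vanishesOnImage f Γ f⊆Γ k a g pullback≈0)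

  homogeneous-linComb-isZero : ∀ {m} d k (g : Fin k → Poly m) → (∀ i → IsHom d (g i)) → (a : Fin k → C) →
                               (∀ j → ∑[ i < k ] (a i * coeff (g i) (exponent d j)) ≈ 0#) →
                               IsZeroPoly (linComb k a g)
  homogeneous-linComb-isZero d k g g-hom a combination e with V.sum e ℕ.≟ d
  ... | yes sum≡d with exponent-surjective d e (≤-reflexive sum≡d)
  ...   | j , ≡.refl = trans (coeff-linComb k a g (exponent d j)) (combination j)
  homogeneous-linComb-isZero d k g g-hom a combination e
      | no sum≢d = trans (coeff-linComb k a g e) (∑-zero λ i → trans (*-congˡ (g-hom i e sum≢d)) (zeroʳ (a i)))

  pullbackDimAtLeast⇒≤ : ∀ {s m} (Γ : PolyMap s m) d k → PullbackDimAtLeast Γ d k → k ≤ suc d ^ m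
  pullbackDimAtLeast⇒≤ Γ d k (g , g-hom , independent) =
    independent⇒≤ _ (λ i j → coeff (g i) (exponent d j)) λ a combination →
      independent a (linComb-pullback-isZero Γ k a g (homogeneous-linComb-isZero d k g g-hom a combination))

  ¬¬-lhom : ∀ {s m} r d (Γ : PolyMap s m) → IsHomMap r Γ → ¬ ¬ (∃ λ l → IsLhom s r m d l)
  ¬¬-lhom {s} {m} r d Γ Γ-hom noLhom =
    ¬¬-∃-maximal Attained (suc d ^ m) (Γ , Γ-hom , pullbackDimAtLeast-zero Γ d)
      (λ (Γ′ , _ , dim≥) → 1+n≰n (pullbackDimAtLeast⇒≤ Γ′ d _ dim≥))
      λ (l , attained , ¬attained) → noLhom (l , attained , λ Γ′ Γ′-hom dim≥ → ¬attained (Γ′ , Γ′-hom , dim≥))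
    where
    Attained : ℕ → Set (c ⊔ ℓ)
    Attained k = ∃ λ (Γ′ : PolyMap s m) → IsHomMap r Γ′ × PullbackDimAtLeast Γ′ d k

proposition3p1 : ∀ {c ℓ} (F : Field c ℓ) (n m s r : ℕ) →
    suc n ≤ m → 2 ≤ suc n → 1 ≤ s → 1 ≤ r → s ≤ m ∸ 1 →
    (f : FieldDefs.PolyMap F n m) →
    (∃ λ d → 1 ≤ d × (∀ l → FieldDefs.IsLhom F s r m d l → FieldDefs.ADimAtLeast F f d (suc l))) →
    FieldDefs.WeaklyElusive F s r f
proposition3p1 F n m s r _ _ _ _ _ f (d , _ , dimA>lhom) Γ Γ-hom f⊆Γ =
  ¬¬-lhom F r d Γ Γ-hom λ (l , lhom@(_ , maximal)) →
    maximal Γ Γ-hom (imageContained⇒pullbackDimAtLeast F f Γ f⊆Γ d (suc l) (dimA>lhom l lhom))
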